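{- Let $p$ and $\ell$ be distinct prime numbers. Then $\gamma_p(\mathbb{Q})\subseteq\mathbb{Z}_{(\ell)}$ if and only if neither $X^p-X+1$ nor $X^p-X-1$ has a zero in $\mathbb{F}_\ell$.
   Context: $\gamma_p(X)=\frac1p\cdot\frac{X^p-X}{(X^p-X)^2-1}$ and $\gamma_p(\mathbb{Q})$ is the set of values $\gamma_p(x)$ for $x\in\mathbb{Q}$ not a pole of $\gamma_p$; $\mathbb{Z}_{(\ell)}$ is the localization of $\mathbb{Z}$ at $\ell$. -}

module Defs where

open import Data.Nat as ℕ using (ℕ; zero; suc)
open import Data.Integer as ℤ using (ℤ; +_)
open import Data.Integer.Divisibility as ℤD using ()
open import Data.Rational as ℚ using (ℚ; 0ℚ; 1ℚ; _*_; _-_; 1/_; ≢-nonZero)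
open import Relation.Nullary using (¬_)
open import Data.Nat.Divisibility as ℕD using ()
open import Data.Product using (Σ; ∃; _,_)
open import Relation.Binary.PropositionalEquality using (_≡_; _≢_)

_^ℚ_ : ℚ → ℕ → ℚ
x ^ℚ zero  = 1ℚ
x ^ℚ suc n = x * (x ^ℚ n)

_^ℤ_ : ℤ → ℕ → ℤ
a ^ℤ zero  = ℤ.+ 1
a ^ℤ suc n = a ℤ.* (a ^ℤ n)

tp : ℕ → ℚ → ℚ
tp p x = (x ^ℚ p) - x

γden : ℕ → ℚ → ℚ
γden p x = ((+ p) ℚ./ 1) * ((tp p x * tp p x) - 1ℚ)

NotPole : ℕ → ℚ → Set
NotPole p x = γden p x ≢ 0ℚ

γ : (p : ℕ) (x : ℚ) → NotPole p x → ℚ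
γ p x np = tp p x * (1/_ (γden p x) {{≢-nonZero np}})

InZloc : ℕ → ℚ → Set
InZloc ℓ q = ¬ (ℓ ℕD.∣ ℚ.ℚ.denominatorℕ q)

HasZeroModℓ : ℕ → ℕ → ℤ → Set
HasZeroModℓ ℓ p c = ∃ λ (a : ℤ) → (+ ℓ) ℤD.∣ ((a ^ℤ p) ℤ.- a ℤ.+ c)

{-# OPTIONS --safe #-}
module Submission where

-- Write p = n + 1 and x = a/b in lowest terms. Then x^p - x = N/D with N = a(a^n - b^n)
-- and D = b^p, so γ_p(x) = ND / (p(N + D)(N - D)). If ℓ divided N + sD for s = ±1, then
-- ℓ ∤ b (otherwise ℓ ∣ a^p, against coprimality), and for c inverse to b modulo ℓ,
-- c^p(N + sD) ≡ (ac)^p - ac + s, a zero of X^p - X + s in 𝔽_ℓ; since also ℓ ∤ p, the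
-- denominator of γ_p(x) is then prime to ℓ. Conversely, a zero of X^p - X + s in 𝔽_ℓ has an
-- integer representative r ≥ 2; at x = r we get D = 1 and ℓ ∣ N + s, so ℓ divides
-- p(N² - 1) = p(N + s)(N - s) but not N ≡ -s, hence ℓ divides the denominator of γ_p(r).

open import Defs
open import Data.Nat as ℕ using (ℕ; zero; suc; 2+)
open import Data.Nat.Primality
  using (Prime; euclidsLemma; ¬prime[0]; ¬prime[1]; prime⇒irreducible; prime⇒nonTrivial; prime⇒nonZero)
open import Data.Integer as ℤ using (ℤ; +_; -[1+_]; _+_; _*_; _-_; -_; 0ℤ; 1ℤ; ∣_∣)
open import Data.Rational as ℚ using (ℚ; mkℚ; 0ℚ; 1ℚ; toℚᵘ; ↥_; ↧_)
open import Data.Product using (_×_; _,_; ∃-syntax)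
open import Data.Sum using (_⊎_; inj₁; inj₂; [_,_]′)
open import Relation.Nullary using (¬_; yes; no)
open import Relation.Binary.PropositionalEquality
open import Function.Bundles using (_⇔_; mk⇔)

import Data.Integer.Properties as ℤ
open import Algebra.Properties.CommutativeSemigroup ℤ.*-commutativeSemigroup
  using (interchange; xy∙z≈xz∙y)
open import Data.Empty using (⊥-elim)
open import Data.Integer.Divisibility.Signed
open import Data.Integer.DivMod using (_%ℕ_; _/ℕ_; a≡a%ℕn+[a/ℕn]*n)
open import Data.Integer.Tactic.RingSolver using (solve-∀)
import Data.Nat.Coprimality as ℕ
import Data.Nat.Divisibility as ℕ
open import Data.Nat.GCD using (module Bézout)
import Data.Nat.Properties as ℕ
open import Data.Rational.Literals using (fromℤ)
import Data.Rational.Properties as ℚ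
open import Data.Rational.Unnormalised as ℚᵘ using (ℚᵘ; mkℚᵘ; *≡*)
open import Data.Rational.Unnormalised.Properties using () renaming (≃-sym to ≃ᵘ-sym)
open import Function.Base using (id; _∘_)
open ≡-Reasoning

^ℤ-nonZero : ∀ i n .{{_ : ℤ.NonZero i}} → ℤ.NonZero (i ^ℤ n)
^ℤ-nonZero i zero    = _
^ℤ-nonZero i (suc n) = ℤ.i*j≢0 i (i ^ℤ n)
  where instance _ = ^ℤ-nonZero i n

1^ℤ : ∀ n → 1ℤ ^ℤ n ≡ 1ℤ
1^ℤ zero    = refl
1^ℤ (suc n) = cong (1ℤ *_) (1^ℤ n)

*-^ℤ : ∀ a b n → (a * b) ^ℤ n ≡ a ^ℤ n * b ^ℤ n
*-^ℤ a b zero    = refl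
*-^ℤ a b (suc n) = trans (cong ((a * b) *_) (*-^ℤ a b n)) (interchange a b (a ^ℤ n) (b ^ℤ n))

∣-^ℤ-diff : ∀ {k u v} n → k ∣ u - v → k ∣ u ^ℤ n - v ^ℤ n
∣-^ℤ-diff zero    _ = divides 0ℤ refl
∣-^ℤ-diff {k} {u} {v} (suc n) k∣u-v =
  subst (k ∣_) (telescope u v (u ^ℤ n) (v ^ℤ n))
    (∣m∣n⇒∣m+n (∣n⇒∣m*n u (∣-^ℤ-diff n k∣u-v)) (∣m⇒∣m*n (v ^ℤ n) k∣u-v))
  where
  telescope : ∀ u v U V → u * (U - V) + (u - v) * V ≡ u * U - v * V
  telescope = solve-∀

∣-^ℤ-1 : ∀ {k u} n → k ∣ u - 1ℤ → k ∣ u ^ℤ n - 1ℤ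
∣-^ℤ-1 {k} {u} n k∣u-1 = subst (λ z → k ∣ u ^ℤ n - z) (1^ℤ n) (∣-^ℤ-diff n k∣u-1)

-- Fractions here are neither reduced nor required to have positive denominator, which is
-- what lets numerators and denominators be computed termwise.
infix 4 _≈_∕_
record _≈_∕_ (u : ℚᵘ) (N D : ℤ) : Set where
  constructor cross
  field cross-mul : ℚᵘ.↥ u * D ≡ N * ℚᵘ.↧ u

≈-neg : ∀ {u N D} → u ≈ N ∕ D → ℚᵘ.- u ≈ - N ∕ D
≈-neg {mkℚᵘ n d} {N} {D} (cross eq) = cross (begin
  - n * D     ≡⟨ ℤ.neg-distribˡ-* n D ⟨
  - (n * D)   ≡⟨ cong -_ eq ⟩
  - (N * b)   ≡⟨ ℤ.neg-distribˡ-* N b ⟩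
  - N * b     ∎)
  where b = + suc d

≈-* : ∀ {u v N D M E} → u ≈ N ∕ D → v ≈ M ∕ E → u ℚᵘ.* v ≈ N * M ∕ (D * E)
≈-* {mkℚᵘ n d} {mkℚᵘ m e} {N} {D} {M} {E} (cross eq₁) (cross eq₂) = cross (begin
  n * m * (D * E)   ≡⟨ interchange n m D E ⟩
  n * D * (m * E)   ≡⟨ cong₂ _*_ eq₁ eq₂ ⟩
  N * b * (M * c)   ≡⟨ interchange N b M c ⟩
  N * M * (b * c)   ∎)
  where
  b = + suc d
  c = + suc e

≈-+ : ∀ {u v N D M E} → u ≈ N ∕ D → v ≈ M ∕ E → u ℚᵘ.+ v ≈ N * E + M * D ∕ (D * E)
≈-+ {mkℚᵘ n d} {mkℚᵘ m e} {N} {D} {M} {E} (cross eq₁) (cross eq₂) = cross (begin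
  (n * c + m * b) * (D * E)           ≡⟨ expand n c m b D E ⟩
  n * D * (c * E) + m * E * (b * D)   ≡⟨ cong₂ (λ x y → x * (c * E) + y * (b * D)) eq₁ eq₂ ⟩
  N * b * (c * E) + M * c * (b * D)   ≡⟨ collect N b c E M D ⟩
  (N * E + M * D) * (b * c)           ∎)
  where
  b = + suc d
  c = + suc e
  expand : ∀ n c m b D E → (n * c + m * b) * (D * E) ≡ n * D * (c * E) + m * E * (b * D)
  expand = solve-∀
  collect : ∀ N b c E M D → N * b * (c * E) + M * c * (b * D) ≡ (N * E + M * D) * (b * c)
  collect = solve-∀

≈-resp-≃ : ∀ {u v N D} → u ℚᵘ.≃ v → u ≈ N ∕ D → v ≈ N ∕ D
≈-resp-≃ {mkℚᵘ n d} {mkℚᵘ m e} {N} {D} (*≡* u≃v) (cross eq) = cross (ℤ.*-cancelʳ-≡ _ _ b (begin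
  m * D * b   ≡⟨ xy∙z≈xz∙y m D b ⟩
  m * b * D   ≡⟨ cong (_* D) u≃v ⟨
  n * c * D   ≡⟨ xy∙z≈xz∙y n c D ⟩
  n * D * c   ≡⟨ cong (_* c) eq ⟩
  N * b * c   ≡⟨ xy∙z≈xz∙y N b c ⟩
  N * c * b   ∎))
  where
  b = + suc d
  c = + suc e

≈-unique : ∀ {u N D N′ D′} → u ≈ N ∕ D → u ≈ N′ ∕ D′ → N * D′ ≡ N′ * D
≈-unique {mkℚᵘ n d} {N} {D} {N′} {D′} (cross eq) (cross eq′) = ℤ.*-cancelʳ-≡ _ _ b (begin
  N * D′ * b   ≡⟨ xy∙z≈xz∙y N D′ b ⟩
  N * b * D′   ≡⟨ cong (_* D′) eq ⟨
  n * D * D′   ≡⟨ xy∙z≈xz∙y n D D′ ⟩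
  n * D′ * D   ≡⟨ cong (_* D) eq′ ⟩
  N′ * b * D   ≡⟨ xy∙z≈xz∙y N′ b D ⟩
  N′ * D * b   ∎)
  where b = + suc d

≈-rescale : ∀ {u N D N′ D′} .{{_ : ℤ.NonZero D}} → N * D′ ≡ N′ * D → u ≈ N ∕ D → u ≈ N′ ∕ D′
≈-rescale {mkℚᵘ n d} {N} {D} {N′} {D′} N∕D≡N′∕D′ (cross eq) = cross (ℤ.*-cancelʳ-≡ _ _ D (begin
  n * D′ * D   ≡⟨ xy∙z≈xz∙y n D′ D ⟩
  n * D * D′   ≡⟨ cong (_* D′) eq ⟩
  N * b * D′   ≡⟨ xy∙z≈xz∙y N b D′ ⟩
  N * D′ * b   ≡⟨ cong (_* b) N∕D≡N′∕D′ ⟩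
  N′ * D * b   ≡⟨ xy∙z≈xz∙y N′ D b ⟩
  N′ * b * D   ∎))
  where b = + suc d

≈-fromCross : ∀ q {N D} → ↥ q * D ≡ N * ↧ q → toℚᵘ q ≈ N ∕ D
≈-fromCross (mkℚ _ _ _) eq = cross eq

≈-self : ∀ q → toℚᵘ q ≈ ↥ q ∕ ↧ q
≈-self q = ≈-fromCross q refl

≈-≢0 : ∀ {q N D} → toℚᵘ q ≈ N ∕ D → N ≢ 0ℤ → q ≢ 0ℚ
≈-≢0 {N = N} (cross eq) N≢0 refl = N≢0 (sym (trans eq (ℤ.*-identityʳ N)))

toℚᵘ-≈-neg : ∀ {N D} q → toℚᵘ q ≈ N ∕ D → toℚᵘ (ℚ.- q) ≈ - N ∕ D
toℚᵘ-≈-neg q h = ≈-resp-≃ (≃ᵘ-sym (ℚ.toℚᵘ-homo‿- q)) (≈-neg h)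

toℚᵘ-≈-+ : ∀ {N D M E} p q → toℚᵘ p ≈ N ∕ D → toℚᵘ q ≈ M ∕ E →
           toℚᵘ (p ℚ.+ q) ≈ N * E + M * D ∕ (D * E)
toℚᵘ-≈-+ p q hp hq = ≈-resp-≃ (≃ᵘ-sym (ℚ.toℚᵘ-homo-+ p q)) (≈-+ hp hq)

toℚᵘ-≈-* : ∀ {N D M E} p q → toℚᵘ p ≈ N ∕ D → toℚᵘ q ≈ M ∕ E →
           toℚᵘ (p ℚ.* q) ≈ N * M ∕ (D * E)
toℚᵘ-≈-* p q hp hq = ≈-resp-≃ (≃ᵘ-sym (ℚ.toℚᵘ-homo-* p q)) (≈-* hp hq)

toℚᵘ-≈-^ : ∀ {N D} q n → toℚᵘ q ≈ N ∕ D → toℚᵘ (q ^ℚ n) ≈ N ^ℤ n ∕ D ^ℤ n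
toℚᵘ-≈-^ q zero    h = cross refl
toℚᵘ-≈-^ q (suc n) h = toℚᵘ-≈-* q (q ^ℚ n) h (toℚᵘ-≈-^ q n h)

toℚᵘ-≈-/1 : ∀ n → toℚᵘ (+ n ℚ./ 1) ≈ + n ∕ 1ℤ
toℚᵘ-≈-/1 n = ≈-resp-≃ (≃ᵘ-sym (ℚ.toℚᵘ-fromℚᵘ (mkℚᵘ (+ n) 0))) (cross refl)

tpNum : ℕ → ℚ → ℤ
tpNum n x = ↥ x * ((↥ x) ^ℤ n - (↧ x) ^ℤ n)

tpDen : ℕ → ℚ → ℤ
tpDen n x = (↧ x) ^ℤ suc n

γNum : ℕ → ℚ → ℤ
γNum n x = tpNum n x * tpDen n x

γDen : ℕ → ℚ → ℤ
γDen n x = + suc n * (tpNum n x * tpNum n x - tpDen n x * tpDen n x)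

tp-≈ : ∀ n x → toℚᵘ (tp (suc n) x) ≈ tpNum n x ∕ tpDen n x
tp-≈ n x = ≈-rescale {{ℤ.i*j≢0 B b {{^ℤ-nonZero b (suc n)}}}} (cancel-b a b (a ^ℤ n) (b ^ℤ n))
  (toℚᵘ-≈-+ _ _ (toℚᵘ-≈-^ x (suc n) (≈-self x)) (toℚᵘ-≈-neg x (≈-self x)))
  where
  a = ↥ x
  b = ↧ x
  B = b ^ℤ suc n
  cancel-b : ∀ a b A B → (a * A * b + - a * (b * B)) * (b * B) ≡ a * (A - B) * (b * B * b)
  cancel-b = solve-∀

γden-≈ : ∀ n x → toℚᵘ (γden (suc n) x) ≈ γDen n x ∕ (tpDen n x * tpDen n x)
γden-≈ n x = subst₂ (toℚᵘ (γden (suc n) x) ≈_∕_) (num-eq (+ suc n) N D) (den-eq D)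
  (toℚᵘ-≈-* _ _ (toℚᵘ-≈-/1 (suc n))
    (toℚᵘ-≈-+ _ _ (toℚᵘ-≈-* t t (tp-≈ n x) (tp-≈ n x)) (toℚᵘ-≈-neg {1ℤ} {1ℤ} 1ℚ (cross refl))))
  where
  t = tp (suc n) x
  N = tpNum n x
  D = tpDen n x
  num-eq : ∀ p N D → p * (N * N * 1ℤ + - 1ℤ * (D * D)) ≡ p * (N * N - D * D)
  num-eq = solve-∀
  den-eq : ∀ D → 1ℤ * (D * D * 1ℤ) ≡ D * D
  den-eq = solve-∀

γDen≢0⇒notPole : ∀ n x → γDen n x ≢ 0ℤ → NotPole (suc n) x
γDen≢0⇒notPole n x = ≈-≢0 (γden-≈ n x)

γ-≈ : ∀ n x np → toℚᵘ (γ (suc n) x np) ≈ γNum n x ∕ γDen n x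
γ-≈ n x np = ≈-fromCross g (ℤ.*-cancelʳ-≡ _ _ D {{^ℤ-nonZero (↧ x) (suc n)}} (begin
  G * K * D         ≡⟨ ≈-unique (toℚᵘ-≈-* g (γden p x) (≈-self g) (γden-≈ n x)) g·γden≈t ⟩
  N * (H * (D * D)) ≡⟨ regroup N H D ⟩
  N * D * H * D     ∎))
  where
  p = suc n
  g = γ p x np
  G = ↥ g
  H = ↧ g
  K = γDen n x
  N = tpNum n x
  D = tpDen n x
  g·γden≡t : g ℚ.* γden p x ≡ tp p x
  g·γden≡t = begin
    tp p x ℚ.* 1/γden ℚ.* γden p x     ≡⟨ ℚ.*-assoc (tp p x) 1/γden (γden p x) ⟩
    tp p x ℚ.* (1/γden ℚ.* γden p x)   ≡⟨ cong (tp p x ℚ.*_) (ℚ.*-inverseˡ (γden p x)) ⟩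
    tp p x ℚ.* 1ℚ                      ≡⟨ ℚ.*-identityʳ (tp p x) ⟩
    tp p x                             ∎
    where
    instance _ = ℚ.≢-nonZero np
    1/γden = ℚ.1/ γden p x
  g·γden≈t : toℚᵘ (g ℚ.* γden p x) ≈ N ∕ D
  g·γden≈t = subst (λ q → toℚᵘ q ≈ N ∕ D) (sym g·γden≡t) (tp-≈ n x)
  regroup : ∀ N H D → N * (H * (D * D)) ≡ N * D * H * D
  regroup = solve-∀

-- r divides N = r(r^n - 1), so N² = 1 would make r a unit.
integer-not-pole : ∀ n r → 1 ℕ.< r → NotPole (suc n) (fromℤ (+ r))
integer-not-pole n r 1<r = γDen≢0⇒notPole n x γDen≢0
  where
  x = fromℤ (+ r)
  N = tpNum n x
  D = tpDen n x
  r∤1 : ¬ + r ∣ 1ℤ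
  r∤1 r∣1 = ℕ.<⇒≢ 1<r (sym (ℕ.∣1⇒≡1 (∣⇒∣ᵤ r∣1)))
  N²-D²≢0 : N * N - D * D ≢ 0ℤ
  N²-D²≢0 eq = r∤1 (subst (+ r ∣_) N²≡1 (∣m⇒∣m*n N (∣m⇒∣m*n _ ∣-refl)))
    where
    N²≡1 : N * N ≡ 1ℤ
    N²≡1 = trans (ℤ.i-j≡0⇒i≡j _ _ eq) (cong (λ d → d * d) (1^ℤ (suc n)))
  γDen≢0 : γDen n x ≢ 0ℤ
  γDen≢0 eq with ℤ.i*j≡0⇒i≡0∨j≡0 (+ suc n) eq
  ... | inj₁ ()
  ... | inj₂ N²-D²≡0 = N²-D²≢0 N²-D²≡0

root-shift : ∀ {k u v} n s → k ∣ u - v → k ∣ u ^ℤ n - u + s → k ∣ v ^ℤ n - v + s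
root-shift {k} {u} {v} n s k∣u-v k∣root =
  subst (k ∣_) (shift (u ^ℤ n) (v ^ℤ n) u v s)
    (∣m∣n⇒∣m-n k∣root (∣m∣n⇒∣m-n (∣-^ℤ-diff n k∣u-v) k∣u-v))
  where
  shift : ∀ U V u v s → U - u + s - ((U - V) - (u - v)) ≡ V - v + s
  shift = solve-∀

-- c^(n+1) (a(a^n - b^n) + s b^(n+1)) is the same form at (ac, bc), and bc ≡ 1.
dehomogenise-root : ∀ {k} a b c s n → k ∣ b * c - 1ℤ →
                    k ∣ a * (a ^ℤ n - b ^ℤ n) + s * b ^ℤ suc n → k ∣ (a * c) ^ℤ suc n - a * c + s
dehomogenise-root {k} a b c s n k∣bc-1 k∣F = subst (k ∣_) identity
  (∣m∣n⇒∣m-n (∣m∣n⇒∣m+n (∣n⇒∣m*n (c ^ℤ suc n) k∣F) (∣n⇒∣m*n (a * c) (∣-^ℤ-1 {u = b * c} n k∣bc-1)))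
             (∣n⇒∣m*n s (∣-^ℤ-1 {u = b * c} (suc n) k∣bc-1)))
  where
  A = a ^ℤ n
  B = b ^ℤ n
  C = c ^ℤ n
  homogeneity : ∀ a b c s A B C →
    c * C * (a * (A - B) + s * (b * B)) + a * c * (B * C - 1ℤ) - s * (b * c * (B * C) - 1ℤ)
      ≡ a * c * (A * C) - a * c + s
  homogeneity = solve-∀
  identity : c ^ℤ suc n * (a * (A - B) + s * b ^ℤ suc n) + a * c * ((b * c) ^ℤ n - 1ℤ)
               - s * ((b * c) ^ℤ suc n - 1ℤ)
             ≡ (a * c) ^ℤ suc n - a * c + s
  identity rewrite *-^ℤ a c n | *-^ℤ b c n = homogeneity a b c s A B C

∣-leading-power : ∀ {k} a b s n → k ∣ b →
                  k ∣ a * (a ^ℤ suc n - b ^ℤ suc n) + s * b ^ℤ 2+ n → k ∣ a ^ℤ 2+ n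
∣-leading-power {k} a b s n k∣b k∣F = subst (k ∣_) (isolate a b s (a ^ℤ suc n) (b ^ℤ n))
  (∣m∣n⇒∣m-n (∣m∣n⇒∣m+n k∣F (∣n⇒∣m*n a (∣m⇒∣m*n _ k∣b))) (∣n⇒∣m*n s (∣m⇒∣m*n _ k∣b)))
  where
  isolate : ∀ a b s A B → a * (A - b * B) + s * (b * (b * B)) + a * (b * B) - s * (b * (b * B)) ≡ a * A
  isolate = solve-∀

k∣a-[k+a%ℕk] : ∀ k .{{_ : ℕ.NonZero k}} a → + k ∣ a - + (k ℕ.+ a %ℕ k)
k∣a-[k+a%ℕk] k a = divides (a /ℕ k - 1ℤ) (begin
  a - + (k ℕ.+ r)             ≡⟨ cong₂ _-_ (a≡a%ℕn+[a/ℕn]*n a k) (ℤ.pos-+ k r) ⟩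
  + r + q * + k - (+ k + + r) ≡⟨ regroup (+ r) q (+ k) ⟩
  (q - 1ℤ) * + k              ∎)
  where
  r = a %ℕ k
  q = a /ℕ k
  regroup : ∀ r q k → r + q * k - (k + r) ≡ (q - 1ℤ) * k
  regroup = solve-∀

coprime⇒inverse : ∀ {k m} → ℕ.Coprime k m → ∃[ c ] + k ∣ + m * c - 1ℤ
coprime⇒inverse {k} {m} coprime with ℕ.coprime-Bézout coprime
... | Bézout.+- x y 1+ym≡xk = - + y , divides (- + x) (begin
  + m * - + y - 1ℤ       ≡⟨ regroup (+ m) (+ y) ⟩
  - (1ℤ + + y * + m)     ≡⟨ cong (λ z → - (1ℤ + z)) (ℤ.pos-* y m) ⟨
  - + (1 ℕ.+ y ℕ.* m)    ≡⟨ cong (λ z → - + z) 1+ym≡xk ⟩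
  - + (x ℕ.* k)          ≡⟨ cong -_ (ℤ.pos-* x k) ⟩
  - (+ x * + k)          ≡⟨ ℤ.neg-distribˡ-* (+ x) (+ k) ⟩
  - + x * + k            ∎)
  where
  regroup : ∀ m y → m * - y - 1ℤ ≡ - (1ℤ + y * m)
  regroup = solve-∀
... | Bézout.-+ x y 1+xk≡ym = + y , divides (+ x) (begin
  + m * + y - 1ℤ         ≡⟨ cong (_- 1ℤ) (ℤ.*-comm (+ m) (+ y)) ⟩
  + y * + m - 1ℤ         ≡⟨ cong (_- 1ℤ) (ℤ.pos-* y m) ⟨
  + (y ℕ.* m) - 1ℤ       ≡⟨ cong (λ z → + z - 1ℤ) 1+xk≡ym ⟨
  + (1 ℕ.+ x ℕ.* k) - 1ℤ ≡⟨ cong (_- 1ℤ) (ℤ.pos-+ 1 (x ℕ.* k)) ⟩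
  1ℤ + + (x ℕ.* k) - 1ℤ  ≡⟨ cancel-1 (+ (x ℕ.* k)) ⟩
  + (x ℕ.* k)            ≡⟨ ℤ.pos-* x k ⟩
  + x * + k              ∎)
  where
  cancel-1 : ∀ z → 1ℤ + z - 1ℤ ≡ z
  cancel-1 = solve-∀

≈∕-∤⇒InZloc : ∀ {ℓ q K M} → toℚᵘ q ≈ M ∕ K → ¬ + ℓ ∣ K → InZloc ℓ q
≈∕-∤⇒InZloc {ℓ} {mkℚ a d coprime} {K} {M} (cross eq) ℓ∤K ℓ∣den =
  ℓ∤K (∣ᵤ⇒∣ (ℕ.∣-trans ℓ∣den den∣K))
  where
  den∣K : suc d ℕ.∣ ∣ K ∣
  den∣K = ℕ.coprime-divisor (ℕ.sym (ℕ.recompute coprime)) (ℕ.divides ∣ M ∣ (begin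
    ∣ a ∣ ℕ.* ∣ K ∣    ≡⟨ ℤ.abs-* a K ⟨
    ∣ a * K ∣          ≡⟨ cong ∣_∣ eq ⟩
    ∣ M * + suc d ∣    ≡⟨ ℤ.abs-* M (+ suc d) ⟩
    ∣ M ∣ ℕ.* suc d    ∎))

module _ {ℓ} (ℓ-prime : Prime ℓ) where

  prime-∣-* : ∀ i j → + ℓ ∣ i * j → (+ ℓ ∣ i) ⊎ (+ ℓ ∣ j)
  prime-∣-* i j ℓ∣ij with euclidsLemma ∣ i ∣ ∣ j ∣ ℓ-prime (subst (ℓ ℕ.∣_) (ℤ.abs-* i j) (∣⇒∣ᵤ ℓ∣ij))
  ... | inj₁ ℓ∣i = inj₁ (∣ᵤ⇒∣ ℓ∣i)
  ... | inj₂ ℓ∣j = inj₂ (∣ᵤ⇒∣ ℓ∣j)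

  prime-∤-unit : ∀ {s} → s * s ≡ 1ℤ → ¬ + ℓ ∣ s
  prime-∤-unit {s} s²≡1 ℓ∣s =
    ¬prime[1] (subst Prime (ℕ.∣1⇒≡1 (∣⇒∣ᵤ (subst (+ ℓ ∣_) s²≡1 (∣m⇒∣m*n s ℓ∣s)))) ℓ-prime)

  prime-∣-^ℤ : ∀ a n → + ℓ ∣ a ^ℤ suc n → + ℓ ∣ a
  prime-∣-^ℤ a zero    ℓ∣a¹   = [ id , ⊥-elim ∘ prime-∤-unit refl ]′ (prime-∣-* a 1ℤ ℓ∣a¹)
  prime-∣-^ℤ a (suc n) ℓ∣aⁿ⁺² = [ id , prime-∣-^ℤ a n ]′ (prime-∣-* a (a ^ℤ suc n) ℓ∣aⁿ⁺²)

  prime∤⇒coprime : ∀ {m} → ¬ ℓ ℕ.∣ m → ℕ.Coprime ℓ m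
  prime∤⇒coprime ℓ∤m (d∣ℓ , d∣m) with prime⇒irreducible ℓ-prime d∣ℓ
  ... | inj₁ d≡1  = d≡1
  ... | inj₂ refl = ⊥-elim (ℓ∤m d∣m)

  ∤-distinct-prime : ∀ {p} → Prime p → ℓ ≢ p → ¬ ℓ ℕ.∣ p
  ∤-distinct-prime p-prime ℓ≢p ℓ∣p with prime⇒irreducible p-prime ℓ∣p
  ... | inj₁ refl = ¬prime[1] ℓ-prime
  ... | inj₂ ℓ≡p  = ℓ≢p ℓ≡p

  ≈∕-∣-∤⇒¬InZloc : ∀ {q K M} → toℚᵘ q ≈ M ∕ K → + ℓ ∣ K → ¬ + ℓ ∣ M → ¬ InZloc ℓ q
  ≈∕-∣-∤⇒¬InZloc {q@(mkℚ a _ _)} {K} {M} (cross eq) ℓ∣K ℓ∤M ℓ∤den =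
    [ ℓ∤M , ℓ∤den ∘ ∣⇒∣ᵤ ]′ (prime-∣-* M (↧ q) (subst (+ ℓ ∣_) eq (∣n⇒∣m*n a ℓ∣K)))

  ∣tpNum+s*tpDen⇒root : ∀ n x s → + ℓ ∣ tpNum (suc n) x + s * tpDen (suc n) x →
                         HasZeroModℓ ℓ (2+ n) s
  ∣tpNum+s*tpDen⇒root n (mkℚ a d coprime) s ℓ∣F with ℓ ℕ.∣? suc d
  ... | yes ℓ∣b = ⊥-elim (¬prime[1] (subst Prime (ℕ.recompute coprime (ℓ∣a , ℓ∣b)) ℓ-prime))
    where
    ℓ∣a : ℓ ℕ.∣ ∣ a ∣
    ℓ∣a = ∣⇒∣ᵤ (prime-∣-^ℤ a (suc n) (∣-leading-power a (+ suc d) s n (∣ᵤ⇒∣ ℓ∣b) ℓ∣F))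
  ... | no ℓ∤b with coprime⇒inverse (prime∤⇒coprime ℓ∤b)
  ...   | c , ℓ∣bc-1 = a * c , ∣⇒∣ᵤ (dehomogenise-root a (+ suc d) c s (suc n) ℓ∣bc-1 ℓ∣F)

  no-roots⇒γ-InZloc : ∀ n → ¬ ℓ ℕ.∣ 2+ n →
                      ¬ HasZeroModℓ ℓ (2+ n) 1ℤ → ¬ HasZeroModℓ ℓ (2+ n) (- 1ℤ) →
                      ∀ x np → InZloc ℓ (γ (2+ n) x np)
  no-roots⇒γ-InZloc n ℓ∤p no-root₊ no-root₋ x np = ≈∕-∤⇒InZloc (γ-≈ (suc n) x np) ℓ∤γDen
    where
    p = + 2+ n
    N = tpNum (suc n) x
    D = tpDen (suc n) x
    factor : ∀ p N D → p * (N * N - D * D) ≡ p * ((N + 1ℤ * D) * (N + - 1ℤ * D))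
    factor = solve-∀
    ℓ∤p·[N+D]·[N-D] : ¬ + ℓ ∣ p * ((N + 1ℤ * D) * (N + - 1ℤ * D))
    ℓ∤p·[N+D]·[N-D] ℓ∣ with prime-∣-* p _ ℓ∣
    ... | inj₁ ℓ∣p = ℓ∤p (∣⇒∣ᵤ ℓ∣p)
    ... | inj₂ ℓ∣N²-D² with prime-∣-* (N + 1ℤ * D) (N + - 1ℤ * D) ℓ∣N²-D²
    ...   | inj₁ ℓ∣N+D = no-root₊ (∣tpNum+s*tpDen⇒root n x 1ℤ ℓ∣N+D)
    ...   | inj₂ ℓ∣N-D = no-root₋ (∣tpNum+s*tpDen⇒root n x (- 1ℤ) ℓ∣N-D)
    ℓ∤γDen : ¬ + ℓ ∣ γDen (suc n) x
    ℓ∤γDen = ℓ∤p·[N+D]·[N-D] ∘ subst (+ ℓ ∣_) (factor p N D)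

  γ-InZloc⇒no-root : ∀ n s → s * s ≡ 1ℤ → (∀ x np → InZloc ℓ (γ (suc n) x np)) →
                     ¬ HasZeroModℓ ℓ (suc n) s
  γ-InZloc⇒no-root n s s²≡1 γ-InZloc (a , ℓ∣root) =
    ≈∕-∣-∤⇒¬InZloc (γ-≈ n x np) ℓ∣γDen ℓ∤γNum (γ-InZloc x np)
    where
    instance
      _ = prime⇒nonZero ℓ-prime
      _ = prime⇒nonTrivial ℓ-prime
    r = ℓ ℕ.+ a %ℕ ℓ
    x = fromℤ (+ r)
    np = integer-not-pole n r (ℕ.<-≤-trans (ℕ.nonTrivial⇒n>1 ℓ) (ℕ.m≤m+n ℓ (a %ℕ ℓ)))
    p = + suc n
    N = tpNum n x
    D = tpDen n x
    ℓ∣N+s : + ℓ ∣ N + s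
    ℓ∣N+s = subst (+ ℓ ∣_) root≡N+s (root-shift {u = a} (suc n) s (k∣a-[k+a%ℕk] ℓ a) (∣ᵤ⇒∣ ℓ∣root))
      where
      expand : ∀ r R s → r * R - r + s ≡ r * (R - 1ℤ) + s
      expand = solve-∀
      root≡N+s : (+ r) ^ℤ suc n - + r + s ≡ N + s
      root≡N+s = trans (expand (+ r) ((+ r) ^ℤ n) s)
                       (cong (λ o → + r * ((+ r) ^ℤ n - o) + s) (sym (1^ℤ n)))
    γDen≡ : γDen n x ≡ p * ((N + s) * (N - s))
    γDen≡ = begin
      p * (N * N - D * D)     ≡⟨ cong (λ d → p * (N * N - d * d)) (1^ℤ (suc n)) ⟩
      p * (N * N - 1ℤ)        ≡⟨ cong (λ u → p * (N * N - u)) s²≡1 ⟨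
      p * (N * N - s * s)     ≡⟨ factor p N s ⟩
      p * ((N + s) * (N - s)) ∎
      where
      factor : ∀ p N s → p * (N * N - s * s) ≡ p * ((N + s) * (N - s))
      factor = solve-∀
    ℓ∣γDen : + ℓ ∣ γDen n x
    ℓ∣γDen = subst (+ ℓ ∣_) (sym γDen≡) (∣n⇒∣m*n p (∣m⇒∣m*n (N - s) ℓ∣N+s))
    ℓ∤γNum : ¬ + ℓ ∣ γNum n x
    ℓ∤γNum ℓ∣ND = prime-∤-unit s²≡1 (∣m+n∣m⇒∣n ℓ∣N+s ℓ∣N)
      where
      ℓ∣N : + ℓ ∣ N
      ℓ∣N = subst (+ ℓ ∣_) (trans (cong (N *_) (1^ℤ (suc n))) (ℤ.*-identityʳ N)) ℓ∣ND

lemma2p7 : (p ℓ : ℕ) → Prime p → Prime ℓ → p ≢ ℓ →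
    ((∀ (x : ℚ) (np : NotPole p x) → InZloc ℓ (γ p x np))
      ⇔ (¬ HasZeroModℓ ℓ p (+ 1) × ¬ HasZeroModℓ ℓ p -[1+ 0 ]))
lemma2p7 zero       _ 0-prime _ _ = ⊥-elim (¬prime[0] 0-prime)
lemma2p7 (suc zero) _ 1-prime _ _ = ⊥-elim (¬prime[1] 1-prime)
lemma2p7 (2+ n) ℓ p-prime ℓ-prime p≢ℓ = mk⇔
  (λ γ-InZloc → γ-InZloc⇒no-root ℓ-prime (suc n) 1ℤ refl γ-InZloc
              , γ-InZloc⇒no-root ℓ-prime (suc n) (- 1ℤ) refl γ-InZloc)
  (λ (no-root₊ , no-root₋) →
    no-roots⇒γ-InZloc ℓ-prime n (∤-distinct-prime ℓ-prime p-prime (≢-sym p≢ℓ)) no-root₊ no-root₋)
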